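{- Let $\mathcal{A}=(Q,E,s,F)$ be an NFA and let $\mathcal{A}^*=(Q^*,E^*,s^*,F^*)$ be the powerset automaton obtained from $\mathcal{A}$. Let $n_{\preceq_\mathcal{A}}=|Q/_{\preceq_\mathcal{A}}|$ and $n^*=|Q^*|$. Let $r$ be the width of $\preceq_\mathcal{A}$ and $r^*$ the width of $\preceq_{\mathcal{A}^*}$. Then (1) $r^*\le 2^r-1$; (2) $n^*\le 2^r(n_{\preceq_\mathcal{A}}-r+1)-1$.
   Context: $\Sigma$ is a finite alphabet with a fixed total order $\preceq$, extended to $\Sigma^*$ co-lexicographically: $\alpha\preceq\beta$ iff the reverse of $\alpha$ is lexicographically $\le$ the reverse of $\beta$ ($\prec$ its strict part). An NFA is $\mathcal{A}=(Q,E,s,F)$ with finite state set $Q$, $E\subseteq Q\times Q\times\Sigma$, initial state $s$ and final states $F$; it is assumed that every state is reachable from $s$ and every state can reach a final state. $\mathcal{L}(\mathcal{A})$ is the recognized language and $Pref(\mathcal{L}(\mathcal{A}))$ its set of prefixes. For $u\in Q$, $I_u$ is the set of strings that can be read from $s$ to $u$; for $\alpha\in Pref(\mathcal{L}(\mathcal{A}))$, $I_\alpha$ is the set of states $u$ with $\alpha\in I_u$. On $\{I_u:u\in Q\}$, $\preceq$ is the reflexive relation such that for $I_u\neq I_v$: $I_u\prec I_v$ iff for all $\alpha\in I_u$, $\beta\in I_v$ with $\{\alpha,\beta\}\not\subseteq I_u\cap I_v$, $\alpha\prec\beta$. Define $u\preceq_\mathcal{A} v$ iff $I_u\preceq I_v$;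 this is a preorder on $Q$. $Q/_{\preceq_\mathcal{A}}$ is the set of equivalence classes of the relation $u\sim v$ iff $u\preceq_\mathcal{A}v$ and $v\preceq_\mathcal{A}u$. The width of a preorder is the minimum size of a partition of its ground set into sets whose elements are pairwise comparable. The powerset automaton has $Q^*=\{I_\alpha:\alpha\in Pref(\mathcal{L}(\mathcal{A}))\}$, $E^*=\{(I_\alpha,I_{\alpha a},a): \alpha a\in Pref(\mathcal{L}(\mathcal{A}))\}$, $s^*=I_\varepsilon=\{s\}$, $F^*=\{I_\alpha:\alpha\in\mathcal{L}(\mathcal{A})\}$; $\preceq_{\mathcal{A}^*}$ is defined on the DFA $\mathcal{A}^*$ in the same way as $\preceq_\mathcal{A}$ on $\mathcal{A}$. -}

module Defs where

open import Data.Nat using (ℕ; _≤_)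
open import Data.Fin using (Fin; _<_)
open import Data.Fin.Subset using (Subset; _∈_; ⁅_⁆)
open import Data.List using (List; []; _∷_; _++_; [_]; reverse)
open import Data.Product using (Σ; ∃; _×_; _,_)
open import Data.Sum using (_⊎_)
open import Data.Unit using (⊤)
open import Relation.Nullary using (¬_)
open import Relation.Binary.PropositionalEquality using (_≡_; _≢_)
open import Function using (_⇔_)

Word : ℕ → Set
Word σ = List (Fin σ)

data _≤lex_ {σ : ℕ} : Word σ → Word σ → Set where
  []≤  : ∀ {β} → [] ≤lex β
  <≤   : ∀ {a b α β} → a < b → (a ∷ α) ≤lex (b ∷ β)
  ≡≤   : ∀ {a α β} → α ≤lex β → (a ∷ α) ≤lex (a ∷ β)

_⪯_ : {σ : ℕ} → Word σ → Word σ → Set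
α ⪯ β = reverse α ≤lex reverse β

_≺_ : {σ : ℕ} → Word σ → Word σ → Set
α ≺ β = α ⪯ β × α ≢ β

record Automaton (σ : ℕ) : Set₁ where
  field
    Q : Set
    E : Q → Q → Fin σ → Set      -- E u v a : edge u --a--> v
    s : Q
    F : Q → Set

module _ {σ : ℕ} (A : Automaton σ) where
  open Automaton A

  data Reads : Q → Word σ → Q → Set where
    nil  : ∀ {u} → Reads u [] u
    cons : ∀ {u w v a α} → E u w a → Reads w α v → Reads u (a ∷ α) v

  I : Q → Word σ → Set
  I u α = Reads s α u

  Lang : Word σ → Set
  Lang α = Σ Q λ f → F f × Reads s α f

  Pref : Word σ → Set
  Pref α = Σ (Word σ) λ β → Lang (α ++ β)

  SameI : Q → Q → Set
  SameI u v = ∀ α → I u α ⇔ I v α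

  -- I_u ⪯ I_v  (reflexive; for I_u ≠ I_v the paper's condition)
  _≤I_ : Q → Q → Set
  u ≤I v = SameI u v
         ⊎ (¬ SameI u v
            × (∀ α β → I u α → I v β
                 → ¬ ((I u α × I v α) × (I u β × I v β)) → α ≺ β))

record NFA (σ : ℕ) : Set₁ where
  field
    n : ℕ
    E : Fin n → Fin n → Fin σ → Set
    s : Fin n
    F : Fin n → Set

  aut : Automaton σ
  aut = record { Q = Fin n ; E = E ; s = s ; F = F }

module _ {σ : ℕ} (A : NFA σ) where
  open NFA A

  Trim : Set
  Trim = (∀ u → Σ (Word σ) λ α → Reads aut s α u)
       × (∀ u → Σ (Word σ) λ α → Σ (Fin n) λ f → F f × Reads aut u α f)

  _≤A_ : Fin n → Fin n → Set
  _≤A_ = _≤I_ aut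

  _∼A_ : Fin n → Fin n → Set
  u ∼A v = u ≤A v × v ≤A u

  IsI : Word σ → Subset n → Set
  IsI α X = ∀ u → (u ∈ X) ⇔ Reads aut s α u

  InQ* : Subset n → Set
  InQ* X = Σ (Word σ) λ α → Pref aut α × IsI α X

  -- the powerset automaton A*, with states Subset n (only those in Q* are
  -- reachable / considered)
  powerset : Automaton σ
  powerset = record
    { Q = Subset n
    ; E = λ X Y a → Σ (Word σ) λ α → Pref aut (α ++ [ a ]) × IsI α X × IsI (α ++ [ a ]) Y
    ; s = ⁅ s ⁆
    ; F = λ X → Σ (Word σ) λ α → Lang aut α × IsI α X
    }

  _≤A*_ : Subset n → Subset n → Set
  _≤A*_ = _≤I_ powerset

HasCard : {T : Set} → (T → Set) → (T → T → Set) → ℕ → Set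
HasCard {T} G _≈_ m =
  Σ (Fin m → T) λ f →
      (∀ i → G (f i))
    × (∀ x → G x → Σ (Fin m) λ i → f i ≈ x)
    × (∀ i j → f i ≈ f j → i ≡ j)

ChainPartition : {T : Set} → (T → Set) → (T → T → Set) → ℕ → Set
ChainPartition {T} G R k =
  Σ (T → Fin k) λ c → ∀ x y → G x → G y → c x ≡ c y → R x y ⊎ R y x

Width : {T : Set} → (T → Set) → (T → T → Set) → ℕ → Set
Width G R r = ChainPartition G R r × (∀ k → ChainPartition G R k → r ≤ k)

All : {T : Set} → T → Set
All _ = ⊤

-- Fix a partition of the ∼-classes of A into r chains; minimality of r forces every chain to
-- contain a class. Each state I_α of A* is convex for ⪯_A, so it meets every chain in an
-- interval; call the set of chains it meets its support. For two states of A* with the same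
-- support, reached by α ≺ β, both ends of these intervals move up from I_α to I_β. Hence such
-- states are ⪯_{A*}-comparable, and colouring Q* by the (nonempty) support gives r* ≤ 2^r − 1.
-- Moreover, the total position of the interval ends separates the states with support S and
-- takes at most 1 + Σ_{i∈S} 2(m_i − 1) values, m_i being the number of classes in chain i;
-- summing over S gives n* ≤ 2^r (n_⪯ − r + 1) − 1. Neither reading a word nor ⪯_A is
-- decidable, so the argument runs in the double-negation monad, which is harmless because the
-- conclusion is decidable.

module Submission where

open import Defs
open import Data.Nat using (ℕ; _≤_; _+_; _*_; _∸_; _^_)
open import Data.Product using (_×_)
open import Relation.Binary.PropositionalEquality using (_≡_)

open import Data.Bool using (if_then_else_)
import Data.Bool as Bool
open import Data.Fin as Fin using (Fin; zero; suc; toℕ; fromℕ<; punchOut; splitAt; _↑ˡ_; _↑ʳ_)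
import Data.Fin.Properties as Fin
open import Data.Fin.Subset
  using (Subset; _∈_; _⊆_; ∣_∣; ⁅_⁆; ⊥; inside; outside)
open import Data.Fin.Subset.Properties
  using ( _∈?_; ⊆-reflexive; ⊆-antisym; ⊥⊆; ∉⊥; ∣⊥∣≡0; x∈⁅x⁆; x∈⁅y⁆⇒x≡y
        ; p⊆q⇒∣p∣≤∣q∣; p⊂q⇒∣p∣<∣q∣)
open import Data.List using ([]; _∷_; _++_; [_]; _∷ʳ_; reverse)
import Data.List.Properties as List
open import Data.List.Reverse using (Reverse; []; _∶_∶ʳ_; reverseView)
import Data.Nat as ℕ
open import Data.Nat using (zero; suc; _<_; z≤n; s≤s)
import Data.Nat.Properties as ℕ
open import Data.Nat.Tactic.RingSolver using (solve-∀)
open import Algebra.Properties.CommutativeMonoid.Sum ℕ.+-0-commutativeMonoid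
  using (sum-syntax; sum-cong-≗; ∑-distrib-+; sum-replicate-zero)
open import Data.Product using (Σ; ∃; _,_; proj₁; proj₂)
open import Data.Sum using (_⊎_; inj₁; inj₂)
import Data.Sum as Sum
open import Data.Unit using (tt)
open import Data.Vec using ([]; _∷_; tabulate)
open import Data.Vec.Base using (here; there)
import Data.Vec.Properties as Vec
open import Effect.Monad using (RawMonad)
open import Function using (_∘_; id; Injective)
open import Function.Bundles using (_⇔_; mk⇔; Equivalence)
open import Relation.Binary.Definitions using (tri<; tri≈; tri>)
open import Relation.Binary.PropositionalEquality
  using (_≢_; refl; sym; trans; cong; cong₂; subst; module ≡-Reasoning)
open import Relation.Nullary using (¬_; Dec; yes; no; does)
open import Relation.Nullary.Decidable using (_×-dec_; map′; decidable-stable; ¬¬-excluded-middle)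
open import Relation.Nullary.Negation using (contradiction; DoubleNegation; ¬¬-Monad; ¬¬-map)
open import Relation.Unary using (Pred; Decidable)

open Equivalence using (to; from)

private
  module ¬¬ {a} = RawMonad (¬¬-Monad {a})
open ¬¬ using (pure; _>>=_)

-- Co-lexicographic order

module _ {σ : ℕ} where

  ≤lex-total : (α β : Word σ) → α ≤lex β ⊎ β ≤lex α
  ≤lex-total []      β       = inj₁ []≤
  ≤lex-total (a ∷ α) []      = inj₂ []≤
  ≤lex-total (a ∷ α) (b ∷ β) with Fin.<-cmp a b
  ... | tri< a<b _ _ = inj₁ (<≤ a<b)
  ... | tri> _ _ b<a = inj₂ (<≤ b<a)
  ... | tri≈ _ refl _ = Sum.map ≡≤ ≡≤ (≤lex-total α β)

  ≤lex-antisym : {α β : Word σ} → α ≤lex β → β ≤lex α → α ≡ β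
  ≤lex-antisym []≤      []≤      = refl
  ≤lex-antisym (<≤ a<b) (<≤ b<a) = contradiction b<a (Fin.<-asym a<b)
  ≤lex-antisym (<≤ a<a) (≡≤ _)   = contradiction a<a (Fin.<-irrefl refl)
  ≤lex-antisym (≡≤ _)   (<≤ a<a) = contradiction a<a (Fin.<-irrefl refl)
  ≤lex-antisym (≡≤ α≤β) (≡≤ β≤α) = cong (_ ∷_) (≤lex-antisym α≤β β≤α)

  ≤lex-trans : {α β γ : Word σ} → α ≤lex β → β ≤lex γ → α ≤lex γ
  ≤lex-trans []≤      _        = []≤
  ≤lex-trans (<≤ a<b) (<≤ b<c) = <≤ (Fin.<-trans a<b b<c)
  ≤lex-trans (<≤ a<b) (≡≤ _)   = <≤ a<b
  ≤lex-trans (≡≤ _)   (<≤ a<c) = <≤ a<c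
  ≤lex-trans (≡≤ α≤β) (≡≤ β≤γ) = ≡≤ (≤lex-trans α≤β β≤γ)

  ⪯-antisym : {α β : Word σ} → α ⪯ β → β ⪯ α → α ≡ β
  ⪯-antisym α⪯β β⪯α = List.reverse-injective (≤lex-antisym α⪯β β⪯α)

  ≺-asym : {α β : Word σ} → α ≺ β → ¬ β ≺ α
  ≺-asym (α⪯β , α≢β) (β⪯α , _) = α≢β (⪯-antisym α⪯β β⪯α)

  ≺-trans : {α β γ : Word σ} → α ≺ β → β ≺ γ → α ≺ γ
  ≺-trans (α⪯β , α≢β) (β⪯γ , _) =
    ≤lex-trans α⪯β β⪯γ , λ { refl → α≢β (⪯-antisym α⪯β β⪯γ) }

  ≺-trichotomy : (α β : Word σ) → α ≡ β ⊎ α ≺ β ⊎ β ≺ α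
  ≺-trichotomy α β with List.≡-dec Fin._≟_ α β
  ... | yes α≡β = inj₁ α≡β
  ... | no α≢β with ≤lex-total (reverse α) (reverse β)
  ...   | inj₁ α⪯β = inj₂ (inj₁ (α⪯β , α≢β))
  ...   | inj₂ β⪯α = inj₂ (inj₂ (β⪯α , α≢β ∘ sym))

  ≺-stable : {α β : Word σ} → DoubleNegation (α ≺ β) → α ≺ β
  ≺-stable {α} {β} ¬¬α≺β with ≺-trichotomy α β
  ... | inj₁ refl        = contradiction (λ (_ , α≢α) → α≢α refl) ¬¬α≺β
  ... | inj₂ (inj₁ α≺β) = α≺β
  ... | inj₂ (inj₂ β≺α) = contradiction (≺-asym β≺α) ¬¬α≺β

-- Counting

¬¬-∀-Fin : ∀ {p n} {P : Pred (Fin n) p} →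
           (∀ i → DoubleNegation (P i)) → DoubleNegation (∀ i → P i)
¬¬-∀-Fin {n = zero}  _   = pure λ ()
¬¬-∀-Fin {n = suc n} ¬¬P = do
  P₀ ← ¬¬P zero
  Pₛ ← ¬¬-∀-Fin (¬¬P ∘ suc)
  pure λ { zero → P₀ ; (suc i) → Pₛ i }

select : ∀ {n p} {P : Pred (Fin n) p} → Decidable P → Subset n
select P? = tabulate (does ∘ P?)

∈-select : ∀ {n p} {P : Pred (Fin n) p} (P? : Decidable P) {x} → x ∈ select P? ⇔ P x
∈-select P? = mk⇔ (select⁻ P?) (select⁺ P?)
  where
  select⁻ : ∀ {n} {P : Pred (Fin n) _} (P? : Decidable P) {x} → x ∈ select P? → P x
  select⁻ P? {zero} x∈ with P? zero | x∈
  ... | yes Px | _ = Px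
  select⁻ P? {suc x} (there x∈) = select⁻ (P? ∘ suc) x∈
  select⁺ : ∀ {n} {P : Pred (Fin n) _} (P? : Decidable P) {x} → P x → x ∈ select P?
  select⁺ P? {zero} Px with P? zero
  ... | yes _  = here
  ... | no ¬Px = contradiction Px ¬Px
  select⁺ P? {suc x} Px = there (select⁺ (P? ∘ suc) Px)

p⊆q∧∣q∣≤∣p∣⇒p≡q : ∀ {n} {p q : Subset n} → p ⊆ q → ∣ q ∣ ≤ ∣ p ∣ → p ≡ q
p⊆q∧∣q∣≤∣p∣⇒p≡q {p = p} {q} p⊆q ∣q∣≤∣p∣ = ⊆-antisym p⊆q q⊆p
  where
  q⊆p : q ⊆ p
  q⊆p {x} x∈q with x ∈? p
  ... | yes x∈p = x∈p
  ... | no  x∉p = contradiction (p⊂q⇒∣p∣<∣q∣ (p⊆q , x , x∈q , x∉p)) (ℕ.≤⇒≯ ∣q∣≤∣p∣)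

x∈p⇒1≤∣p∣ : ∀ {n} {p : Subset n} {x} → x ∈ p → 1 ≤ ∣ p ∣
x∈p⇒1≤∣p∣ {n} {p} {x} x∈p =
  subst (_< ∣ p ∣) (∣⊥∣≡0 n) (p⊂q⇒∣p∣<∣q∣ (⊥⊆ , x , x∈p , ∉⊥))

fibre : ∀ {m r} → (Fin m → Fin r) → Fin r → Subset m
fibre κ i = select (λ j → κ j Fin.≟ i)

∈-fibre : ∀ {m r} (κ : Fin m → Fin r) {i j} → j ∈ fibre κ i ⇔ κ j ≡ i
∈-fibre κ {i} = ∈-select (λ j → κ j Fin.≟ i)

∑-∣fibre∣ : ∀ {m r} (κ : Fin m → Fin r) → ∑[ i < r ] ∣ fibre κ i ∣ ≡ m
∑-∣fibre∣ {zero}  {r} κ = sum-replicate-zero r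
∑-∣fibre∣ {suc m} {r} κ = begin
  ∑[ i < r ] ∣ fibre κ i ∣
    ≡⟨ sum-cong-≗ (λ i → ∣∷∣ (does (κ zero Fin.≟ i)) (fibre (κ ∘ suc) i)) ⟩
  ∑[ i < r ] (δ (κ zero) i + ∣ fibre (κ ∘ suc) i ∣)
    ≡⟨ ∑-distrib-+ (δ (κ zero)) _ ⟩
  ∑[ i < r ] δ (κ zero) i + ∑[ i < r ] ∣ fibre (κ ∘ suc) i ∣
    ≡⟨ cong₂ _+_ (∑-δ (κ zero)) (∑-∣fibre∣ (κ ∘ suc)) ⟩
  suc m ∎
  where
  open ≡-Reasoning
  δ : ∀ {r} → Fin r → Fin r → ℕ
  δ k i = if does (k Fin.≟ i) then 1 else 0
  ∣∷∣ : ∀ {m} b (p : Subset m) → ∣ b ∷ p ∣ ≡ (if b then 1 else 0) + ∣ p ∣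
  ∣∷∣ inside  _ = refl
  ∣∷∣ outside _ = refl
  ∑-δ : ∀ {r} (k : Fin r) → ∑[ i < r ] δ k i ≡ 1
  ∑-δ {suc r} zero    = cong suc (sum-replicate-zero r)
  ∑-δ {suc r} (suc k) = ∑-δ k

∑-Subset : ∀ r → (Subset r → ℕ) → ℕ
∑-Subset zero    B = B []
∑-Subset (suc r) B = ∑-Subset r (B ∘ (outside ∷_)) + ∑-Subset r (B ∘ (inside ∷_))

∑-Subset-cong : ∀ r {B B′ : Subset r → ℕ} →
                (∀ S → B S ≡ B′ S) → ∑-Subset r B ≡ ∑-Subset r B′
∑-Subset-cong zero    B≗B′ = B≗B′ []
∑-Subset-cong (suc r) B≗B′ =
  cong₂ _+_ (∑-Subset-cong r (B≗B′ ∘ (outside ∷_))) (∑-Subset-cong r (B≗B′ ∘ (inside ∷_)))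

↑ˡ≢↑ʳ : ∀ {m n} (i : Fin m) (j : Fin n) → i ↑ˡ n ≢ m ↑ʳ j
↑ˡ≢↑ʳ {m} {n} i j eq
  with trans (sym (Fin.splitAt-↑ˡ m i n)) (trans (cong (splitAt m) eq) (Fin.splitAt-↑ʳ m n j))
... | ()

inject-∑-Subset : ∀ {r} (B : Subset r → ℕ) (S : Subset r) → Fin (B S) → Fin (∑-Subset r B)
inject-∑-Subset B []            p = p
inject-∑-Subset B (outside ∷ S) p = inject-∑-Subset (B ∘ (outside ∷_)) S p ↑ˡ _
inject-∑-Subset B (inside ∷ S)  p = _ ↑ʳ inject-∑-Subset (B ∘ (inside ∷_)) S p

inject-∑-Subset-injective : ∀ {r} (B : Subset r → ℕ) {S S′ p p′} →
  inject-∑-Subset B S p ≡ inject-∑-Subset B S′ p′ → S ≡ S′ × toℕ p ≡ toℕ p′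
inject-∑-Subset-injective B {[]} {[]} eq = refl , cong toℕ eq
inject-∑-Subset-injective B {outside ∷ S} {outside ∷ S′} eq
  with inject-∑-Subset-injective (B ∘ (outside ∷_)) {S} {S′} (Fin.↑ˡ-injective _ _ _ eq)
... | refl , p≡p′ = refl , p≡p′
inject-∑-Subset-injective B {inside ∷ S} {inside ∷ S′} eq
  with inject-∑-Subset-injective (B ∘ (inside ∷_)) {S} {S′} (Fin.↑ʳ-injective _ _ _ eq)
... | refl , p≡p′ = refl , p≡p′
inject-∑-Subset-injective B {outside ∷ _} {inside ∷ _} eq = contradiction eq (↑ˡ≢↑ʳ _ _)
inject-∑-Subset-injective B {inside ∷ _} {outside ∷ _} eq = contradiction (sym eq) (↑ˡ≢↑ʳ _ _)

sumOver : ∀ {r} → Subset r → (Fin r → ℕ) → ℕ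
sumOver []            f = 0
sumOver (outside ∷ S) f = sumOver S (f ∘ suc)
sumOver (inside ∷ S)  f = f zero + sumOver S (f ∘ suc)

sumOver-mono-≤ : ∀ {r} (S : Subset r) {f g : Fin r → ℕ} →
                 (∀ {i} → i ∈ S → f i ≤ g i) → sumOver S f ≤ sumOver S g
sumOver-mono-≤ []            f≤g = z≤n
sumOver-mono-≤ (outside ∷ S) f≤g = sumOver-mono-≤ S (f≤g ∘ there)
sumOver-mono-≤ (inside ∷ S)  f≤g = ℕ.+-mono-≤ (f≤g here) (sumOver-mono-≤ S (f≤g ∘ there))

+-mono-≤-≡ : ∀ {m m′ n n′} → m ≤ m′ → n ≤ n′ → m + n ≡ m′ + n′ → m ≡ m′ × n ≡ n′
+-mono-≤-≡ {m} m≤m′ n≤n′ eq with ℕ.m≤n⇒m<n∨m≡n m≤m′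
... | inj₁ m<m′ = contradiction eq (ℕ.<⇒≢ (ℕ.+-mono-<-≤ m<m′ n≤n′))
... | inj₂ refl = refl , ℕ.+-cancelˡ-≡ m _ _ eq

sumOver-mono-≤-≡ : ∀ {r} (S : Subset r) {f g : Fin r → ℕ} →
  (∀ {i} → i ∈ S → f i ≤ g i) → sumOver S f ≡ sumOver S g → ∀ {i} → i ∈ S → f i ≡ g i
sumOver-mono-≤-≡ (outside ∷ S) f≤g eq (there i∈S) = sumOver-mono-≤-≡ S (f≤g ∘ there) eq i∈S
sumOver-mono-≤-≡ (inside ∷ S)  f≤g eq here =
  proj₁ (+-mono-≤-≡ (f≤g here) (sumOver-mono-≤ S (f≤g ∘ there)) eq)
sumOver-mono-≤-≡ (inside ∷ S)  f≤g eq (there i∈S) = sumOver-mono-≤-≡ S (f≤g ∘ there)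
  (proj₂ (+-mono-≤-≡ (f≤g here) (sumOver-mono-≤ S (f≤g ∘ there)) eq)) i∈S

∑-Subset-const : ∀ r c → ∑-Subset r (λ _ → c) ≡ 2 ^ r * c
∑-Subset-const zero    c = sym (ℕ.+-identityʳ c)
∑-Subset-const (suc r) c =
  trans (cong₂ _+_ (∑-Subset-const r c) (∑-Subset-const r c)) (lemma (2 ^ r) c)
  where
  lemma : ∀ P c → P * c + P * c ≡ (P + (P + 0)) * c
  lemma = solve-∀

-- Each i lies in half of the 2 ^ r subsets, so the weights 2 * f i sum to 2 ^ r * f i.
∑-Subset-sumOver : ∀ r c (f : Fin r → ℕ) →
  ∑-Subset r (λ S → c + sumOver S (λ i → 2 * f i)) ≡ 2 ^ r * (c + ∑[ i < r ] f i)
∑-Subset-sumOver zero    c f = sym (ℕ.+-identityʳ (c + 0))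
∑-Subset-sumOver (suc r) c f = begin
  ∑-Subset r (λ S → c + sumOver S (λ i → 2 * f (suc i)))
    + ∑-Subset r (λ S → c + (2 * f zero + sumOver S (λ i → 2 * f (suc i))))
      ≡⟨ cong (∑-Subset r (λ S → c + sumOver S (λ i → 2 * f (suc i))) +_)
           (∑-Subset-cong r (λ S → sym (ℕ.+-assoc c (2 * f zero) _))) ⟩
  ∑-Subset r (λ S → c + sumOver S (λ i → 2 * f (suc i)))
    + ∑-Subset r (λ S → (c + 2 * f zero) + sumOver S (λ i → 2 * f (suc i)))
      ≡⟨ cong₂ _+_ (∑-Subset-sumOver r c (f ∘ suc))
                   (∑-Subset-sumOver r (c + 2 * f zero) (f ∘ suc)) ⟩
  2 ^ r * (c + ∑[ i < r ] f (suc i)) + 2 ^ r * (c + 2 * f zero + ∑[ i < r ] f (suc i))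
      ≡⟨ lemma (2 ^ r) c (f zero) _ ⟩
  2 ^ suc r * (c + ∑[ i < suc r ] f i) ∎
  where
  open ≡-Reasoning
  lemma : ∀ P c f₀ s → P * (c + s) + P * (c + 2 * f₀ + s) ≡ (P + (P + 0)) * (c + (f₀ + s))
  lemma = solve-∀

∑-∸1 : ∀ {r} (f : Fin r → ℕ) → (∀ i → 1 ≤ f i) → ∑[ i < r ] (f i ∸ 1) + r ≡ ∑[ i < r ] f i
∑-∸1 {zero}  f 1≤f = refl
∑-∸1 {suc r} f 1≤f = begin
  (f zero ∸ 1) + ∑[ i < r ] (f (suc i) ∸ 1) + suc r   ≡⟨ shuffle (f zero ∸ 1) _ r ⟩
  suc (f zero ∸ 1) + (∑[ i < r ] (f (suc i) ∸ 1) + r) ≡⟨ cong₂ _+_ suc[f₀∸1]≡f₀ (∑-∸1 (f ∘ suc) (1≤f ∘ suc)) ⟩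
  f zero + ∑[ i < r ] f (suc i)                        ∎
  where
  open ≡-Reasoning
  shuffle : ∀ a b c → a + b + suc c ≡ suc a + (b + c)
  shuffle = solve-∀
  suc[f₀∸1]≡f₀ : suc (f zero ∸ 1) ≡ f zero
  suc[f₀∸1]≡f₀ = trans (ℕ.+-comm 1 (f zero ∸ 1)) (ℕ.m∸n+n≡m (1≤f zero))

injective-missing⇒< : ∀ {m n} {f : Fin m → Fin n} {y} →
                      Injective _≡_ _≡_ f → (∀ i → f i ≢ y) → m < n
injective-missing⇒< {m} {n} {f} {y} f-injective y∉f = Fin.injective⇒≤ extend-injective
  where
  extend : Fin (suc m) → Fin n
  extend zero    = y
  extend (suc i) = f i
  extend-injective : Injective _≡_ _≡_ extend
  extend-injective {zero}  {zero}  _  = refl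
  extend-injective {zero}  {suc j} eq = contradiction (sym eq) (y∉f j)
  extend-injective {suc i} {zero}  eq = contradiction eq (y∉f i)
  extend-injective {suc i} {suc j} eq = cong suc (f-injective eq)

ChainPartition-removeColour : ∀ {T : Set} {G : T → Set} {R : T → T → Set} {m}
  (P : ChainPartition G R m) (i : Fin m) → (∀ x → G x → proj₁ P x ≢ i) → Σ T G →
  ChainPartition G R (m ∸ 1)
ChainPartition-removeColour {T} {G} {R} {suc m} (c , chains) i unused (x₀ , Gx₀) = c′ , chains′
  where
  c′ : T → Fin m
  c′ x with i Fin.≟ c x
  ... | yes _    = punchOut (unused x₀ Gx₀ ∘ sym)
  ... | no  i≢cx = punchOut i≢cx
  chains′ : ∀ x y → G x → G y → c′ x ≡ c′ y → R x y ⊎ R y x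
  chains′ x y Gx Gy eq with i Fin.≟ c x | i Fin.≟ c y
  ... | yes i≡cx | _        = contradiction (sym i≡cx) (unused x Gx)
  ... | no  _    | yes i≡cy = contradiction (sym i≡cy) (unused y Gy)
  ... | no  i≢cx | no  i≢cy = chains x y Gx Gy (Fin.punchOut-injective i≢cx i≢cy eq)

-- Runs of automata

module _ {σ : ℕ} (A : Automaton σ) where

  Reads-++ : ∀ {u v w α β} → Reads A u α v → Reads A v β w → Reads A u (α ++ β) w
  Reads-++ nil        r = r
  Reads-++ (cons e r) r′ = cons e (Reads-++ r r′)

  Reads-split : ∀ α {u w β} → Reads A u (α ++ β) w → ∃ λ v → Reads A u α v × Reads A v β w
  Reads-split []      r          = _ , nil , r
  Reads-split (a ∷ α) (cons e r) with Reads-split α r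
  ... | v , r₁ , r₂ = v , cons e r₁ , r₂

  Pref-++ : ∀ {α} β → Pref A (α ++ β) → Pref A α
  Pref-++ {α} β (γ , accepted) = β ++ γ , subst (Lang A) (List.++-assoc α β γ) accepted

module _ {σ : ℕ} (A : NFA σ) where
  open NFA A

  IsI-unique : ∀ {α X Y} → IsI A α X → IsI A α Y → X ≡ Y
  IsI-unique hX hY = ⊆-antisym (λ {u} → from (hY u) ∘ to (hX u)) (λ {u} → from (hX u) ∘ to (hY u))

  IsI-ε : IsI A [] ⁅ s ⁆
  IsI-ε u = mk⇔ (λ u∈ → subst (Reads aut s []) (sym (x∈⁅y⁆⇒x≡y s u∈)) nil) λ { nil → x∈⁅x⁆ s }

  ¬¬-IsI : ∀ α → DoubleNegation (∃ (IsI A α))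
  ¬¬-IsI α = do
    reads? ← ¬¬-∀-Fin (λ u → ¬¬-excluded-middle)
    pure (select reads? , λ u → ∈-select reads?)

  IsI-∷ʳ : ∀ {α β a Y Z} → IsI A α Y → IsI A β Y → IsI A (α ∷ʳ a) Z → IsI A (β ∷ʳ a) Z
  IsI-∷ʳ {α} {β} {a} hα hβ hαa u = mk⇔ (move hα hβ ∘ to (hαa u)) (from (hαa u) ∘ move hβ hα)
    where
    move : ∀ {α β Y} → IsI A α Y → IsI A β Y → Reads aut s (α ∷ʳ a) u → Reads aut s (β ∷ʳ a) u
    move {α} hα hβ r with Reads-split aut α r
    ... | w , r₁ , r₂ = Reads-++ aut (to (hβ w) (from (hα w) r₁)) r₂

  Reads*⇒IsI : ∀ {α X} → Reads (powerset A) ⁅ s ⁆ α X → IsI A α X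
  Reads*⇒IsI {α} = go (reverseView α)
    where
    go : ∀ {α X} → Reverse α → Reads (powerset A) ⁅ s ⁆ α X → IsI A α X
    go []              nil = IsI-ε
    go (α ∶ rs ∶ʳ a) r with Reads-split (powerset A) α r
    ... | Y , rY , cons (β , _ , hβ , hβa) nil = IsI-∷ʳ hβ (go rs rY) hβa

  IsI⇒Reads* : ∀ {α X} → Pref aut α → IsI A α X →
               DoubleNegation (Reads (powerset A) ⁅ s ⁆ α X)
  IsI⇒Reads* {α} = go (reverseView α)
    where
    go : ∀ {α X} → Reverse α → Pref aut α → IsI A α X →
         DoubleNegation (Reads (powerset A) ⁅ s ⁆ α X)
    go []              _      hX =
      pure (subst (Reads (powerset A) ⁅ s ⁆ []) (IsI-unique IsI-ε hX) nil)
    go (α ∶ rs ∶ʳ a) prefix hX = do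
      Y , hY ← ¬¬-IsI α
      rY ← go rs (Pref-++ aut [ a ] prefix) hY
      pure (Reads-++ (powerset A) rY (cons (α , prefix , hY , hX) nil))

  IsI-nonempty : ∀ {α X} → Pref aut α → IsI A α X → ∃ (_∈ X)
  IsI-nonempty {α} (_ , _ , _ , r) hX with Reads-split aut α r
  ... | u , r₁ , _ = u , from (hX u) r₁

-- The preorder on states

-- u ⊑ v is the paper's condition for I_u ≺ I_v without the clause I_u ≠ I_v. It holds
-- vacuously when I_u = I_v, so it is classically equivalent to _≤I_ while never requiring a
-- split on whether I_u = I_v.
module Precedence {σ : ℕ} (A : Automaton σ) where
  open Automaton A

  _⊑_ : Q → Q → Set
  u ⊑ v = ∀ α β → I A u α → I A v β →
          ¬ ((I A u α × I A v α) × (I A u β × I A v β)) → α ≺ β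

  ⊑-refl : ∀ {u} → u ⊑ u
  ⊑-refl α β uα uβ ¬both = contradiction ((uα , uα) , (uβ , uβ)) ¬both

  ≤I⇒⊑ : ∀ {u v} → _≤I_ A u v → u ⊑ v
  ≤I⇒⊑ (inj₁ u≈v) α β uα vβ ¬both =
    contradiction ((uα , to (u≈v α) uα) , (from (u≈v β) vβ , vβ)) ¬both
  ≤I⇒⊑ (inj₂ (_ , u⊑v)) = u⊑v

  ⊑⇒¬¬≤I : ∀ {u v} → u ⊑ v → DoubleNegation (_≤I_ A u v)
  ⊑⇒¬¬≤I u⊑v =
    ¬¬-map (λ { (yes u≈v) → inj₁ u≈v ; (no u≉v) → inj₂ (u≉v , u⊑v) }) ¬¬-excluded-middle

  ⊑-inversion : ∀ {u v p q} → u ⊑ v → p ≺ q → I A u q → I A v p →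
                DoubleNegation (I A u p) × DoubleNegation (I A v q)
  ⊑-inversion u⊑v p≺q uq vp =
      (λ ¬up → ≺-asym p≺q (u⊑v _ _ uq vp λ ((_ , _) , (up , _)) → ¬up up))
    , (λ ¬vq → ≺-asym p≺q (u⊑v _ _ uq vp λ ((_ , vq) , _) → ¬vq vq))

  module _ (reachable : ∀ u → ∃ (I A u)) where

    ⊑-convex : ∀ {k j l p} → k ⊑ j → j ⊑ l → I A k p → I A l p → DoubleNegation (I A j p)
    ⊑-convex {j = j} k⊑j j⊑l kp lp ¬jp =
      ≺-asym (k⊑j _ _ kp jγ λ ((_ , jp) , _) → ¬jp jp)
             (j⊑l _ _ jγ lp λ (_ , (jp , _)) → ¬jp jp)
      where
      jγ : I A j (proj₁ (reachable j))
      jγ = proj₂ (reachable j)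

    ⊑-trans : ∀ {u v w} → u ⊑ v → v ⊑ w → u ⊑ w
    ⊑-trans {u} {v} {w} u⊑v v⊑w α β uα wβ ¬both = ≺-stable do
      vα? ← ¬¬-excluded-middle
      vβ? ← ¬¬-excluded-middle
      wα? ← ¬¬-excluded-middle
      uβ? ← ¬¬-excluded-middle
      pure (cases vα? vβ? wα? uβ?)
      where
      γ : Word σ
      γ = proj₁ (reachable v)
      vγ : I A v γ
      vγ = proj₂ (reachable v)
      cases : Dec (I A v α) → Dec (I A v β) → Dec (I A w α) → Dec (I A u β) → α ≺ β
      cases (no ¬vα) (yes vβ) _ _ = u⊑v α β uα vβ λ ((_ , vα) , _) → ¬vα vα
      cases (no ¬vα) (no ¬vβ) _ _ =
        ≺-trans (u⊑v α γ uα vγ λ ((_ , vα) , _) → ¬vα vα)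
                (v⊑w γ β vγ wβ λ (_ , (vβ , _)) → ¬vβ vβ)
      cases (yes vα) (no ¬vβ) _ _ = v⊑w α β vα wβ λ (_ , (vβ , _)) → ¬vβ vβ
      cases (yes vα) (yes _) (no ¬wα) _ = v⊑w α β vα wβ λ ((_ , wα) , _) → ¬wα wα
      cases (yes _) (yes vβ) _ (no ¬uβ) = u⊑v α β uα vβ λ (_ , (uβ , _)) → ¬uβ uβ
      cases (yes _) (yes _) (yes wα) (yes uβ) = contradiction ((uα , wα) , (uβ , wβ)) ¬both

-- States of the powerset automaton, seen through a chain partition

module Chains {σ : ℕ} (A : NFA σ) (trim : Trim A)
  (_≤A?_ : ∀ u v → Dec (_≤A_ A u v))
  {nq : ℕ} (rep : Fin nq → Fin (NFA.n A)) (cover : ∀ u → ∃ λ j → _∼A_ A (rep j) u)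
  {r : ℕ} (κ : Fin nq → Fin r)
  (κ-chains : ∀ j k → κ j ≡ κ k → _≤A_ A (rep j) (rep k) ⊎ _≤A_ A (rep k) (rep j))
  where

  open NFA A
  open Precedence aut

  reachable : ∀ u → ∃ (I aut u)
  reachable = proj₁ trim

  ⊑⇒≤A : ∀ {u v} → u ⊑ v → _≤A_ A u v
  ⊑⇒≤A {u} {v} = decidable-stable (u ≤A? v) ∘ ⊑⇒¬¬≤I

  _⊑?_ : ∀ u v → Dec (u ⊑ v)
  u ⊑? v = map′ ≤I⇒⊑ ⊑⇒≤A (u ≤A? v)

  IsI⇒∈ : ∀ {α X u} → IsI A α X → DoubleNegation (I aut u α) → u ∈ X
  IsI⇒∈ {X = X} {u} hX ¬¬uα = decidable-stable (u ∈? X) (¬¬-map (from (hX u)) ¬¬uα)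

  ∈-resp-∼ : ∀ {α X u v} → IsI A α X → u ⊑ v → v ⊑ u → u ∈ X → v ∈ X
  ∈-resp-∼ {u = u} hX u⊑v v⊑u u∈X =
    IsI⇒∈ hX (⊑-convex reachable u⊑v v⊑u (to (hX u) u∈X) (to (hX u) u∈X))

  class : Fin n → Fin nq
  class u = proj₁ (cover u)

  rep-class⊑ : ∀ u → rep (class u) ⊑ u
  rep-class⊑ u = ≤I⇒⊑ (proj₁ (proj₂ (cover u)))

  ⊑rep-class : ∀ u → u ⊑ rep (class u)
  ⊑rep-class u = ≤I⇒⊑ (proj₂ (proj₂ (cover u)))

  κ-comparable : ∀ j k → κ j ≡ κ k → rep j ⊑ rep k ⊎ rep k ⊑ rep j
  κ-comparable j k = Sum.map ≤I⇒⊑ ≤I⇒⊑ ∘ κ-chains j k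

  Witness : Fin r → Subset n → Fin nq → Set
  Witness i X k = rep k ∈ X × κ k ≡ i

  Meets : Subset n → Fin r → Set
  Meets X i = ∃ (Witness i X)

  Below Above : Fin r → Subset n → Fin nq → Set
  Below i X j = κ j ≡ i × ∃ λ k → Witness i X k × rep j ⊑ rep k
  Above i X j = κ j ≡ i × ∃ λ k → Witness i X k × rep k ⊑ rep j

  witness? : ∀ i X k → Dec (Witness i X k)
  witness? i X k = (rep k ∈? X) ×-dec (κ k Fin.≟ i)

  meets? : ∀ X i → Dec (Meets X i)
  meets? X i = Fin.any? (witness? i X)

  below? : ∀ i X j → Dec (Below i X j)
  below? i X j = (κ j Fin.≟ i) ×-dec Fin.any? (λ k → witness? i X k ×-dec (rep j ⊑? rep k))

  above? : ∀ i X j → Dec (Above i X j)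
  above? i X j = (κ j Fin.≟ i) ×-dec Fin.any? (λ k → witness? i X k ×-dec (rep k ⊑? rep j))

  support : Subset n → Subset r
  support X = select (meets? X)

  below above : Fin r → Subset n → Subset nq
  below i X = select (below? i X)
  above i X = select (above? i X)

  ∈-support : ∀ {X i} → i ∈ support X ⇔ Meets X i
  ∈-support {X} = ∈-select (meets? X)

  ∈-below : ∀ {i X j} → j ∈ below i X ⇔ Below i X j
  ∈-below {i} {X} = ∈-select (below? i X)

  ∈-above : ∀ {i X j} → j ∈ above i X ⇔ Above i X j
  ∈-above {i} {X} = ∈-select (above? i X)

  witness∈below : ∀ {i X j} → Witness i X j → j ∈ below i X
  witness∈below w@(_ , κj≡i) = from ∈-below (κj≡i , _ , w , ⊑-refl)

  witness∈above : ∀ {i X j} → Witness i X j → j ∈ above i X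
  witness∈above w@(_ , κj≡i) = from ∈-above (κj≡i , _ , w , ⊑-refl)

  below⇒support : ∀ {i X j} → j ∈ below i X → i ∈ support X
  below⇒support j∈ with to ∈-below j∈
  ... | _ , k , w , _ = from ∈-support (k , w)

  above⇒support : ∀ {i X j} → j ∈ above i X → i ∈ support X
  above⇒support j∈ with to ∈-above j∈
  ... | _ , k , w , _ = from ∈-support (k , w)

  below∩above⇒rep∈ : ∀ {α X i j} → IsI A α X → j ∈ below i X → j ∈ above i X → rep j ∈ X
  below∩above⇒rep∈ hX j∈below j∈above
    with to ∈-below j∈below | to ∈-above j∈above
  ... | _ , k , (k∈X , _) , j⊑k | _ , l , (l∈X , _) , l⊑j =
    IsI⇒∈ hX (⊑-convex reachable l⊑j j⊑k (to (hX _) l∈X) (to (hX _) k∈X))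

  ≡-from-reps : ∀ {p q X Y} → IsI A p X → IsI A q Y →
                (∀ j → rep j ∈ X → rep j ∈ Y) → (∀ j → rep j ∈ Y → rep j ∈ X) → X ≡ Y
  ≡-from-reps hX hY X⇒Y Y⇒X = ⊆-antisym (λ {u} → move hX hY X⇒Y) (λ {u} → move hY hX Y⇒X)
    where
    move : ∀ {p q X Y u} → IsI A p X → IsI A q Y →
           (∀ j → rep j ∈ X → rep j ∈ Y) → u ∈ X → u ∈ Y
    move {u = u} hX hY X⇒Y =
      ∈-resp-∼ hY (rep-class⊑ u) (⊑rep-class u) ∘ X⇒Y _ ∘ ∈-resp-∼ hX (⊑rep-class u) (rep-class⊑ u)

  ≡-from-below-above : ∀ {p q X Y} → IsI A p X → IsI A q Y →
    (∀ i → below i X ≡ below i Y) → (∀ i → above i X ≡ above i Y) → X ≡ Y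
  ≡-from-below-above hX hY below≡ above≡ = ≡-from-reps hX hY (move hY below≡ above≡)
    (move hX (sym ∘ below≡) (sym ∘ above≡))
    where
    move : ∀ {q X Y} → IsI A q Y →
           (∀ i → below i X ≡ below i Y) → (∀ i → above i X ≡ above i Y) →
           ∀ j → rep j ∈ X → rep j ∈ Y
    move hY below≡ above≡ j j∈X = below∩above⇒rep∈ hY
      (subst (j ∈_) (below≡ (κ j)) (witness∈below (j∈X , refl)))
      (subst (j ∈_) (above≡ (κ j)) (witness∈above (j∈X , refl)))

  below-mono : ∀ {p q X Y} → p ≺ q → IsI A p X → IsI A q Y →
               support X ⊆ support Y → ∀ i → below i X ⊆ below i Y
  below-mono {Y = Y} p≺q hX hY S⊆ i j∈ with to ∈-below j∈
  ... | κj≡i , k , wk@(k∈X , κk≡i) , j⊑k with to ∈-support (S⊆ (from ∈-support (k , wk)))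
  ... | u , wu@(u∈Y , κu≡i) with κ-comparable k u (trans κk≡i (sym κu≡i))
  ...   | inj₁ k⊑u = from ∈-below (κj≡i , u , wu , ⊑-trans reachable j⊑k k⊑u)
  ...   | inj₂ u⊑k = from ∈-below (κj≡i , k , (k∈Y , κk≡i) , j⊑k)
    where
    k∈Y : rep k ∈ Y
    k∈Y = IsI⇒∈ hY (proj₂ (⊑-inversion u⊑k p≺q (to (hY _) u∈Y) (to (hX _) k∈X)))

  above-antitone : ∀ {p q X Y} → p ≺ q → IsI A p X → IsI A q Y →
                   support Y ⊆ support X → ∀ i → above i Y ⊆ above i X
  above-antitone {X = X} p≺q hX hY S⊇ i j∈ with to ∈-above j∈
  ... | κj≡i , k , wk@(k∈Y , κk≡i) , k⊑j with to ∈-support (S⊇ (from ∈-support (k , wk)))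
  ... | v , wv@(v∈X , κv≡i) with κ-comparable v k (trans κv≡i (sym κk≡i))
  ...   | inj₁ v⊑k = from ∈-above (κj≡i , v , wv , ⊑-trans reachable v⊑k k⊑j)
  ...   | inj₂ k⊑v = from ∈-above (κj≡i , k , (k∈X , κk≡i) , k⊑j)
    where
    k∈X : rep k ∈ X
    k∈X = IsI⇒∈ hX (proj₁ (⊑-inversion k⊑v p≺q (to (hY _) k∈Y) (to (hX _) v∈X)))

  order-consistent : ∀ {p q p′ q′ X Y} → p ≺ q → q′ ≺ p′ →
    IsI A p X → IsI A q Y → IsI A p′ X → IsI A q′ Y → support X ≡ support Y → X ≡ Y
  order-consistent {X = X} {Y} p≺q q′≺p′ hX hY hX′ hY′ S≡ = ≡-from-below-above hX hY
    (λ i → ⊆-antisym (below-mono p≺q hX hY S⊆ i) (below-mono q′≺p′ hY′ hX′ S⊇ i))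
    (λ i → ⊆-antisym (above-antitone q′≺p′ hY′ hX′ S⊆ i) (above-antitone p≺q hX hY S⊇ i))
    where
    S⊆ : support X ⊆ support Y
    S⊆ = ⊆-reflexive S≡
    S⊇ : support Y ⊆ support X
    S⊇ = ⊆-reflexive (sym S≡)

  ≺⇒≤A* : ∀ {p q X Y} → p ≺ q → Pref aut p → IsI A p X → IsI A q Y → X ≢ Y →
          support X ≡ support Y → _≤A*_ A X Y
  ≺⇒≤A* {p} {X = X} {Y} p≺q p-prefix hX hY X≢Y S≡ = inj₂ (X≉Y , X⊑Y)
    where
    X≉Y : ¬ SameI (powerset A) X Y
    X≉Y X≈Y = IsI⇒Reads* A p-prefix hX λ pX →
      X≢Y (IsI-unique A hX (Reads*⇒IsI A (to (X≈Y p) pX)))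
    X⊑Y : Precedence._⊑_ (powerset A) X Y
    X⊑Y γ δ γX δY _ with ≺-trichotomy γ δ | Reads*⇒IsI A γX | Reads*⇒IsI A δY
    ... | inj₁ refl       | hγ | hδ = contradiction (IsI-unique A hγ hδ) X≢Y
    ... | inj₂ (inj₁ γ≺δ) | _  | _  = γ≺δ
    ... | inj₂ (inj₂ δ≺γ) | hγ | hδ = contradiction (order-consistent p≺q δ≺γ hX hY hγ hδ S≡) X≢Y

  ≡-support⇒comparable : ∀ {X Y} → InQ* A X → InQ* A Y → support X ≡ support Y →
                         _≤A*_ A X Y ⊎ _≤A*_ A Y X
  ≡-support⇒comparable {X} {Y} (p , p-prefix , hX) (q , q-prefix , hY) S≡
    with Vec.≡-dec Bool._≟_ X Y
  ... | yes refl = inj₁ (inj₁ λ _ → mk⇔ id id)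
  ... | no X≢Y with ≺-trichotomy p q
  ...   | inj₁ refl       = contradiction (IsI-unique A hX hY) X≢Y
  ...   | inj₂ (inj₁ p≺q) = inj₁ (≺⇒≤A* p≺q p-prefix hX hY X≢Y S≡)
  ...   | inj₂ (inj₂ q≺p) = inj₂ (≺⇒≤A* q≺p q-prefix hY hX (X≢Y ∘ sym) (sym S≡))

  support-nonempty : ∀ {X} → InQ* A X → ∃ (_∈ support X)
  support-nonempty (_ , p-prefix , hX) with IsI-nonempty A p-prefix hX
  ... | u , u∈X =
    κ (class u) , from ∈-support (class u , ∈-resp-∼ hX (⊑rep-class u) (rep-class⊑ u) u∈X , refl)

  ⁅s⁆∈Q* : InQ* A ⁅ s ⁆
  ⁅s⁆∈Q* = [] , proj₂ trim s , IsI-ε A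

  Q*-chainPartition : ChainPartition (InQ* A) (_≤A*_ A) (2 ^ r ∸ 1)
  Q*-chainPartition =
    subst (λ k → ChainPartition (InQ* A) (_≤A*_ A) (k ∸ 1))
          (trans (∑-Subset-const r 1) (ℕ.*-identityʳ (2 ^ r)))
          (ChainPartition-removeColour (colour , chains) (inject-∑-Subset ones ⊥ zero) unused
                                       (⁅ s ⁆ , ⁅s⁆∈Q*))
    where
    ones : Subset r → ℕ
    ones _ = 1
    colour : Subset n → Fin (∑-Subset r ones)
    colour X = inject-∑-Subset ones (support X) zero
    chains : ∀ X Y → InQ* A X → InQ* A Y → colour X ≡ colour Y → _≤A*_ A X Y ⊎ _≤A*_ A Y X
    chains X Y X∈Q* Y∈Q* eq =
      ≡-support⇒comparable X∈Q* Y∈Q* (proj₁ (inject-∑-Subset-injective ones eq))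
    unused : ∀ X → InQ* A X → colour X ≢ inject-∑-Subset ones ⊥ zero
    unused X X∈Q* eq with support-nonempty X∈Q*
    ... | i , i∈S = ∉⊥ (subst (i ∈_) (proj₁ (inject-∑-Subset-injective ones eq)) i∈S)

  size : Fin r → ℕ
  size i = ∣ fibre κ i ∣

  ∣below∣≤size : ∀ i X → ∣ below i X ∣ ≤ size i
  ∣below∣≤size i X = p⊆q⇒∣p∣≤∣q∣ λ j∈ → from (∈-fibre κ) (proj₁ (to ∈-below j∈))

  ∣above∣≤size : ∀ i X → ∣ above i X ∣ ≤ size i
  ∣above∣≤size i X = p⊆q⇒∣p∣≤∣q∣ λ j∈ → from (∈-fibre κ) (proj₁ (to ∈-above j∈))

  support⇒1≤∣below∣ : ∀ {i X} → i ∈ support X → 1 ≤ ∣ below i X ∣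
  support⇒1≤∣below∣ i∈S = x∈p⇒1≤∣p∣ (witness∈below (proj₂ (to ∈-support i∈S)))

  support⇒1≤∣above∣ : ∀ {i X} → i ∈ support X → 1 ≤ ∣ above i X ∣
  support⇒1≤∣above∣ i∈S = x∈p⇒1≤∣p∣ (witness∈above (proj₂ (to ∈-support i∈S)))

  -- Numbering the classes of chain i as 1, …, size i, and writing [a, b] for the interval
  -- occupied by X, this is (b − 1) + (a − 1).
  height : Fin r → Subset n → ℕ
  height i X = (∣ below i X ∣ ∸ 1) + (size i ∸ ∣ above i X ∣)

  Ψ : Subset n → ℕ
  Ψ X = sumOver (support X) (λ i → height i X)

  weight : Subset r → ℕ
  weight S = suc (sumOver S (λ i → 2 * (size i ∸ 1)))

  height≤ : ∀ {i X} → i ∈ support X → height i X ≤ 2 * (size i ∸ 1)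
  height≤ {i} {X} i∈S = begin
    (∣ below i X ∣ ∸ 1) + (size i ∸ ∣ above i X ∣)
      ≤⟨ ℕ.+-mono-≤ (ℕ.∸-monoˡ-≤ 1 (∣below∣≤size i X))
                    (ℕ.∸-monoʳ-≤ (size i) (support⇒1≤∣above∣ i∈S)) ⟩
    (size i ∸ 1) + (size i ∸ 1)   ≡⟨ cong ((size i ∸ 1) +_) (sym (ℕ.+-identityʳ _)) ⟩
    2 * (size i ∸ 1)              ∎
    where open ℕ.≤-Reasoning

  Ψ<weight : ∀ X → Ψ X < weight (support X)
  Ψ<weight X = s≤s (sumOver-mono-≤ (support X) height≤)

  module SameSupport {p q X Y} (p≺q : p ≺ q) (hX : IsI A p X) (hY : IsI A q Y)
                     (S≡ : support X ≡ support Y) where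

    below⊆ : ∀ i → below i X ⊆ below i Y
    below⊆ = below-mono p≺q hX hY (⊆-reflexive S≡)

    above⊇ : ∀ i → above i Y ⊆ above i X
    above⊇ = above-antitone p≺q hX hY (⊆-reflexive (sym S≡))

    ∣below∣∸1-mono : ∀ i → ∣ below i X ∣ ∸ 1 ≤ ∣ below i Y ∣ ∸ 1
    ∣below∣∸1-mono i = ℕ.∸-monoˡ-≤ 1 (p⊆q⇒∣p∣≤∣q∣ (below⊆ i))

    size∸∣above∣-mono : ∀ i → size i ∸ ∣ above i X ∣ ≤ size i ∸ ∣ above i Y ∣
    size∸∣above∣-mono i = ℕ.∸-monoʳ-≤ (size i) (p⊆q⇒∣p∣≤∣q∣ (above⊇ i))

    height-mono : ∀ i → height i X ≤ height i Y
    height-mono i = ℕ.+-mono-≤ (∣below∣∸1-mono i) (size∸∣above∣-mono i)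

    below≡ : ∀ i → (i ∈ support X → height i X ≡ height i Y) → below i X ≡ below i Y
    below≡ i height≡ with i ∈? support X
    ... | no i∉S = ⊆-antisym (below⊆ i) λ j∈ →
      contradiction (subst (i ∈_) (sym S≡) (below⇒support j∈)) i∉S
    ... | yes i∈S = p⊆q∧∣q∣≤∣p∣⇒p≡q (below⊆ i) (ℕ.≤-reflexive (sym (ℕ.∸-cancelʳ-≡
      (support⇒1≤∣below∣ i∈S) (support⇒1≤∣below∣ (subst (i ∈_) S≡ i∈S))
      (proj₁ (+-mono-≤-≡ (∣below∣∸1-mono i) (size∸∣above∣-mono i) (height≡ i∈S))))))

    above≡ : ∀ i → (i ∈ support X → height i X ≡ height i Y) → above i X ≡ above i Y
    above≡ i height≡ with i ∈? support X
    ... | no i∉S = ⊆-antisym (λ j∈ → contradiction (above⇒support j∈) i∉S) (above⊇ i)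
    ... | yes i∈S = sym (p⊆q∧∣q∣≤∣p∣⇒p≡q (above⊇ i) (ℕ.≤-reflexive (ℕ.∸-cancelˡ-≡
      (∣above∣≤size i X) (∣above∣≤size i Y)
      (proj₂ (+-mono-≤-≡ (∣below∣∸1-mono i) (size∸∣above∣-mono i) (height≡ i∈S))))))

  Ψ-injective : ∀ {p q X Y} → p ≺ q → IsI A p X → IsI A q Y →
                support X ≡ support Y → Ψ X ≡ Ψ Y → X ≡ Y
  Ψ-injective {X = X} {Y} p≺q hX hY S≡ Ψ≡ =
    ≡-from-below-above hX hY (λ i → below≡ i height≡) (λ i → above≡ i height≡)
    where
    open SameSupport p≺q hX hY S≡
    height≡ : ∀ {i} → i ∈ support X → height i X ≡ height i Y
    height≡ = sumOver-mono-≤-≡ (support X) (λ {i} _ → height-mono i)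
      (trans Ψ≡ (cong (λ S → sumOver S (λ i → height i Y)) (sym S≡)))

  code : Subset n → Fin (∑-Subset r weight)
  code X = inject-∑-Subset weight (support X) (fromℕ< (Ψ<weight X))

  code-≡ : ∀ {X Y} → code X ≡ code Y → support X ≡ support Y × Ψ X ≡ Ψ Y
  code-≡ {X} {Y} eq with inject-∑-Subset-injective weight eq
  ... | S≡ , toℕ≡ =
    S≡ , trans (sym (Fin.toℕ-fromℕ< (Ψ<weight X))) (trans toℕ≡ (Fin.toℕ-fromℕ< (Ψ<weight Y)))

  code-injective : ∀ {X Y} → InQ* A X → InQ* A Y → code X ≡ code Y → X ≡ Y
  code-injective (p , _ , hX) (q , _ , hY) eq with code-≡ eq | ≺-trichotomy p q
  ... | _       | inj₁ refl       = IsI-unique A hX hY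
  ... | S≡ , Ψ≡ | inj₂ (inj₁ p≺q) = Ψ-injective p≺q hX hY S≡ Ψ≡
  ... | S≡ , Ψ≡ | inj₂ (inj₂ q≺p) = sym (Ψ-injective q≺p hY hX (sym S≡) (sym Ψ≡))

  code≢code⊥ : ∀ {X} → InQ* A X → code X ≢ inject-∑-Subset weight ⊥ zero
  code≢code⊥ X∈Q* eq with support-nonempty X∈Q*
  ... | i , i∈S = ∉⊥ (subst (i ∈_) (proj₁ (inject-∑-Subset-injective weight eq)) i∈S)

  Q*-size : ∀ {m} (e : Fin m → Subset n) → (∀ i → InQ* A (e i)) → Injective _≡_ _≡_ e →
            m ≤ 2 ^ r * (1 + ∑[ i < r ] (size i ∸ 1)) ∸ 1
  Q*-size e e∈Q* e-injective =
    subst (λ k → _ ≤ k ∸ 1) (∑-Subset-sumOver r 1 (λ i → size i ∸ 1))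
          (ℕ.∸-monoˡ-≤ 1 (injective-missing⇒< code∘e-injective (code≢code⊥ ∘ e∈Q*)))
    where
    code∘e-injective : Injective _≡_ _≡_ (code ∘ e)
    code∘e-injective {i} {j} = e-injective ∘ code-injective (e∈Q* i) (e∈Q* j)

  classChainPartition : ChainPartition All (_≤A_ A) r
  classChainPartition = κ ∘ class , λ x y _ _ eq → Sum.map chain chain (κ-comparable _ _ eq)
    where
    chain : ∀ {x y} → rep (class x) ⊑ rep (class y) → _≤A_ A x y
    chain {x} {y} cx⊑cy =
      ⊑⇒≤A (⊑-trans reachable (⊑-trans reachable (⊑rep-class x) cx⊑cy) (rep-class⊑ y))

  size-positive : (∀ k → ChainPartition All (_≤A_ A) k → r ≤ k) → ∀ i → 1 ≤ size i
  size-positive r-minimal i with Fin.any? (λ j → κ j Fin.≟ i)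
  ... | yes (j , κj≡i) = x∈p⇒1≤∣p∣ (from (∈-fibre κ) κj≡i)
  ... | no ∄j = contradiction (r-minimal _ smaller) (ℕ.<⇒≱ (∸1< i))
    where
    smaller : ChainPartition All (_≤A_ A) (r ∸ 1)
    smaller = ChainPartition-removeColour classChainPartition i (λ x _ eq → ∄j (class x , eq)) (s , tt)
    ∸1< : ∀ {r} → Fin r → r ∸ 1 < r
    ∸1< {suc r} _ = ℕ.n<1+n r

  nq∸r+1≡ : (∀ i → 1 ≤ size i) → nq ∸ r + 1 ≡ 1 + ∑[ i < r ] (size i ∸ 1)
  nq∸r+1≡ 1≤size = begin
    nq ∸ r + 1                           ≡⟨ cong (λ m → m ∸ r + 1) (∑-∣fibre∣ κ) ⟨
    ∑[ i < r ] size i ∸ r + 1            ≡⟨ cong (λ m → m ∸ r + 1) (∑-∸1 size 1≤size) ⟨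
    ∑[ i < r ] (size i ∸ 1) + r ∸ r + 1  ≡⟨ cong (_+ 1) (ℕ.m+n∸n≡m _ r) ⟩
    ∑[ i < r ] (size i ∸ 1) + 1          ≡⟨ ℕ.+-comm _ 1 ⟩
    1 + ∑[ i < r ] (size i ∸ 1)          ∎
    where open ≡-Reasoning

theorem9 : ∀ {σ : ℕ} (A : NFA σ) → Trim A →
    ∀ (r r* nq n* : ℕ) →
    Width All (_≤A_ A) r →
    Width (InQ* A) (_≤A*_ A) r* →
    HasCard All (_∼A_ A) nq →
    HasCard (InQ* A) _≡_ n* →
    (r* ≤ 2 ^ r ∸ 1) × (n* ≤ 2 ^ r * (nq ∸ r + 1) ∸ 1)
theorem9 A trim r r* nq n* ((c , c-chains) , r-minimal) (_ , r*-minimal)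
         (rep , _ , cover , _) (e , e∈Q* , _ , e-injective) =
  decidable-stable ((r* ℕ.≤? 2 ^ r ∸ 1) ×-dec (n* ℕ.≤? 2 ^ r * (nq ∸ r + 1) ∸ 1)) do
    _≤A?_ ← ¬¬-∀-Fin λ u → ¬¬-∀-Fin λ v → ¬¬-excluded-middle
    let open Chains A trim _≤A?_ rep (λ u → cover u tt) (c ∘ rep) (λ j k → c-chains (rep j) (rep k) tt tt)
    pure ( r*-minimal _ Q*-chainPartition
         , subst (λ w → n* ≤ 2 ^ r * w ∸ 1) (sym (nq∸r+1≡ (size-positive r-minimal)))
                 (Q*-size e e∈Q* (e-injective _ _)) )
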